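{- In simplified infinite Mastermind with at least two colors, whether or not duplication of colors is allowed, for no countable ordinal $\gamma$ does the codebreaker have a strategy that always wins by stage $\gamma$. In particular, there is no countable winning set in simplified infinite Mastermind.
   Context: Simplified infinite Mastermind: colors from a set $\Sigma$ with $|\Sigma|\ge 2$; codewords and guesswords are sequences in ${}^\omega\Sigma$ (injective ones in the no-duplication variant). For guess $s$ and codeword $w$ the feedback is the pair of cardinals $\|s=w\|=|\{n\mid s(n)=w(n)\}|$ and $\|s\neq w\|=|\{n\mid s(n)\neq w(n)\}|$. The codebreaker places guesswords $s_\alpha$ at ordinal stages $\alpha$, each a function of the feedback to earlier guesses, and wins when a guess equals the codeword. A set $S$ of guesswords is winning if every codeword is uniquely determined by its feedback on the members of $S$. -}

module Defs where

open import Data.Nat using (ℕ; _≤_)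
open import Data.Fin using (Fin)
open import Data.Product using (Σ; ∃; _×_; _,_)
open import Data.Unit using (⊤)
open import Relation.Nullary using (¬_)
open import Relation.Binary.PropositionalEquality using (_≡_; _≢_)
open import Relation.Binary.Structures using (IsStrictTotalOrder)
open import Induction.WellFounded using (WellFounded)
open import Function.Definitions using (Injective)

-- Cardinals that can occur as feedback: finite k, or ℵ₀ (omega).
data Card : Set where
  fin   : ℕ → Card
  omega : Card

HasSize : (ℕ → Set) → Card → Set
HasSize P (fin k) =
  Σ (Fin k → ℕ) λ e → Injective _≡_ _≡_ e × (∀ i → P (e i)) × (∀ n → P n → ∃ λ i → e i ≡ n)
HasSize P omega = ∀ m → ∃ λ n → m ≤ n × P n

Feedback : Set
Feedback = Card × Card

IsFeedback : {C : Set} → (ℕ → C) → (ℕ → C) → Feedback → Set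
IsFeedback s w (a , b) = HasSize (λ n → s n ≡ w n) a × HasSize (λ n → ¬ (s n ≡ w n)) b

data Variant : Set where
  dup nodup : Variant

Admissible : Variant → {C : Set} → (ℕ → C) → Set
Admissible dup   s = ⊤
Admissible nodup s = Injective _≡_ _≡_ s

-- Standing assumption on the color set: |Σ| ≥ 2; in the no-duplication
-- variant additionally Σ must admit injective sequences (|Σ| ≥ ℵ₀).
EnoughColors : Variant → Set → Set
EnoughColors dup   C = Σ C λ a → Σ C λ b → a ≢ b
EnoughColors nodup C = (Σ C λ a → Σ C λ b → a ≢ b) × (Σ (ℕ → C) λ e → Injective _≡_ _≡_ e)

Word : Variant → Set → Set
Word v C = Σ (ℕ → C) λ s → Admissible v s

seq : ∀ {v C} → Word v C → ℕ → C
seq (s , _) = s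

-- A countable ordinal γ, presented as a countable strict well-order
-- (its elements are the stages α < γ).
record CountableOrdinal : Set₁ where
  field
    Stage   : Set
    _≺_     : Stage → Stage → Set
    isSTO   : IsStrictTotalOrder _≡_ _≺_
    wf      : WellFounded _≺_
    code    : Stage → ℕ
    codeInj : Injective _≡_ _≡_ code

open CountableOrdinal public

Strategy : Variant → Set → CountableOrdinal → Set
Strategy v C γ = (α : Stage γ) → ((β : Stage γ) → _≺_ γ β α → Feedback) → Word v C

guessAt : ∀ {v C γ} → Strategy v C γ → (Stage γ → Feedback) → Stage γ → Word v C
guessAt σ f α = σ α (λ β _ → f β)

Play : ∀ {v C γ} → Strategy v C γ → (ℕ → C) → Set
Play {v} {C} {γ} σ w = Σ (Stage γ → Feedback) λ f → ∀ α → IsFeedback (seq {v} {C} (guessAt {v} {C} {γ} σ f α)) w (f α)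

WinsBy : ∀ {v C γ} → Strategy v C γ → Set
WinsBy {v} {C} {γ} σ = (w : Word v C) → (p : Play {v} {C} {γ} σ (seq {v} {C} w)) →
  ∃ λ (α : Stage γ) → ∀ n → seq {v} {C} (guessAt {v} {C} {γ} σ (Data.Product.proj₁ p) α) n ≡ seq {v} {C} w n

record CountableGuessSet (v : Variant) (C : Set) : Set₁ where
  field
    Index    : Set
    code     : Index → ℕ
    codeInj  : Injective _≡_ _≡_ code
    member   : Index → Word v C

IsWinningSet : ∀ {v C} → CountableGuessSet v C → Set
IsWinningSet {v} {C} S = (w w' : Word v C) →
  (∀ i c → IsFeedback (seq (CountableGuessSet.member S i)) (seq w) c
         → IsFeedback (seq (CountableGuessSet.member S i)) (seq w') c) →
  ∀ n → seq w n ≡ seq w' n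

-- Against any countable family of guesses one can build a codeword that agrees and disagrees
-- with every member infinitely often, so that every guess gets the uninformative feedback
-- (ℵ₀, ℵ₀). A strategy of countable length fed this constant feedback makes countably many
-- guesses, and the codeword built against them is none of them. For a countable set S, a
-- second codeword built against S together with the first one gets the same feedback on S
-- as the first, but differs from it.
--
-- The codeword serves the requirements "agree with guess i" and "differ from guess i" in
-- turn, each infinitely often. Without duplication, an agreement with guess i is promised at
-- a position p where the colour of guess i is still unused, and the positions before p are
-- filled with fresh colours.
module Submission where

open import Defs
open import Axiom.ExcludedMiddle using (ExcludedMiddle)
open import Data.Bool using (Bool; true; false)
open import Data.Empty using (⊥-elim)
open import Data.List using (List; []; _∷_; tabulate)
open import Data.List.Extrema.Nat using (max; xs≤max)
open import Data.List.Membership.Propositional using (_∈_; _∉_)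
open import Data.List.Membership.Propositional.Properties using (∈-tabulate⁺)
import Data.List.Relation.Unary.All as All
open import Data.List.Relation.Unary.Any using (here; there)
open import Data.Nat using (ℕ; zero; suc; _+_; _∸_; _≤_; _<_; z≤n; s≤s; _≟_)
open import Data.Nat.Properties
open import Data.Product using (Σ; ∃; _×_; _,_; proj₁; proj₂)
open import Data.Sum using (inj₁; inj₂)
open import Data.Unit using (tt)
open import Function using (_∘_)
open import Function.Definitions using (Injective)
open import Level using (0ℓ)
open import Relation.Binary.Definitions using (tri<; tri≈; tri>)
open import Relation.Binary.PropositionalEquality
open import Relation.Nullary using (¬_; Dec; yes; no; contradiction)

ωω : Feedback
ωω = omega , omega

fin-size-not-omega : ∀ {P : ℕ → Set} {k} → HasSize P (fin k) → ¬ HasSize P omega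
fin-size-not-omega {k = k} (e , _ , _ , covered) infinite
  with infinite (suc (max 0 (tabulate e)))
... | n , bound<n , Pn with covered n Pn
... | i , refl =
  <-irrefl refl (≤-trans bound<n (All.lookup (xs≤max 0 (tabulate e)) (∈-tabulate⁺ i)))

ωω-feedback-unique : ∀ {C} {s w : ℕ → C} {c} → IsFeedback s w ωω → IsFeedback s w c → c ≡ ωω
ωω-feedback-unique {c = omega , omega} _              _            = refl
ωω-feedback-unique {c = fin k , _}     (infinite , _) (finite , _) =
  ⊥-elim (fin-size-not-omega finite infinite)
ωω-feedback-unique {c = omega , fin k} (_ , infinite) (_ , finite) =
  ⊥-elim (fin-size-not-omega finite infinite)

ωω-feedback⇒≢ : ∀ {C} {s w : ℕ → C} → IsFeedback s w ωω → ¬ (∀ n → s n ≡ w n)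
ωω-feedback⇒≢ (_ , differ) s≗w with differ 0
... | n , _ , sn≢wn = sn≢wn (s≗w n)

zigzag-step : ℕ × ℕ → ℕ × ℕ
zigzag-step (a , suc b) = suc a , b
zigzag-step (a , zero)  = zero , suc a

-- (0,0), (0,1), (1,0), (0,2), (1,1), (2,0), … : the anti-diagonals of ℕ × ℕ in turn.
zigzag : ℕ → ℕ × ℕ
zigzag zero    = 0 , 0
zigzag (suc n) = zigzag-step (zigzag n)

zigzag-along-diagonal : ∀ c n a b → zigzag n ≡ (a , c + b) → zigzag (c + n) ≡ (c + a , b)
zigzag-along-diagonal zero    n a b eq = eq
zigzag-along-diagonal (suc c) n a b eq
  with zigzag-along-diagonal c (suc n) (suc a) b (cong zigzag-step eq)
... | reached rewrite +-suc c n | +-suc c a = reached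

zigzag-hits-column₀ : ∀ s → ∃ λ n → zigzag n ≡ (0 , s)
zigzag-hits-column₀ zero    = 0 , refl
zigzag-hits-column₀ (suc s) with zigzag-hits-column₀ s
... | n , eq with zigzag-along-diagonal s n 0 0 (trans eq (cong (0 ,_) (sym (+-identityʳ s))))
... | end-of-diagonal =
  suc (s + n) , trans (cong zigzag-step end-of-diagonal) (cong (λ m → 0 , suc m) (+-identityʳ s))

zigzag-surjective : ∀ a b → ∃ λ n → zigzag n ≡ (a , b)
zigzag-surjective a b with zigzag-hits-column₀ (a + b)
... | n , eq = a + n , trans (zigzag-along-diagonal a n 0 b eq) (cong (_, b) (+-identityʳ a))

zigzag-sum-≤ : ∀ n → proj₁ (zigzag n) + proj₂ (zigzag n) ≤ n
zigzag-sum-≤ zero    = z≤n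
zigzag-sum-≤ (suc n) = ≤-trans (step-sum (zigzag n)) (s≤s (zigzag-sum-≤ n))
  where
    step-sum : ∀ p → proj₁ (zigzag-step p) + proj₂ (zigzag-step p) ≤ suc (proj₁ p + proj₂ p)
    step-sum (a , suc b) rewrite +-suc a b = n≤1+n _
    step-sum (a , zero)  rewrite +-identityʳ a = ≤-refl

Requirement : Set
Requirement = ℕ × Bool

decodeRequirement : ℕ → Requirement
decodeRequirement zero          = 0 , true
decodeRequirement (suc zero)    = 0 , false
decodeRequirement (suc (suc n)) = suc (proj₁ (decodeRequirement n)) , proj₂ (decodeRequirement n)

encodeRequirement : Requirement → ℕ
encodeRequirement (zero  , true)  = 0
encodeRequirement (zero  , false) = 1
encodeRequirement (suc i , b)     = suc (suc (encodeRequirement (i , b)))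

decode-encode : ∀ q → decodeRequirement (encodeRequirement q) ≡ q
decode-encode (zero  , true)  = refl
decode-encode (zero  , false) = refl
decode-encode (suc i , b) rewrite decode-encode (i , b) = refl

schedule : ℕ → Requirement
schedule = decodeRequirement ∘ proj₁ ∘ zigzag

schedule-recurrent : ∀ q m → ∃ λ r → m ≤ r × schedule r ≡ q
schedule-recurrent q m with zigzag-surjective (encodeRequirement q) m
... | r , eq =
  r , ≤-trans (m≤n+m m _) (subst (λ p → proj₁ p + proj₂ p ≤ r) eq (zigzag-sum-≤ r)) ,
  trans (cong (decodeRequirement ∘ proj₁) eq) (decode-encode q)

earlier-distinct⇒injective : ∀ {A : Set} {f : ℕ → A} → (∀ {j k} → j < k → f j ≢ f k) →
                             Injective _≡_ _≡_ f
earlier-distinct⇒injective distinct {j} {k} eq with <-cmp j k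
... | tri< j<k _ _ = contradiction eq (distinct j<k)
... | tri≈ _ j≡k _ = j≡k
... | tri> _ _ k<j = contradiction (sym eq) (distinct k<j)

module Classical (em : ExcludedMiddle 0ℓ) where

  extend-along-injection : ∀ {I A : Set} → A → (code : I → ℕ) → Injective _≡_ _≡_ code →
                           (f : I → A) → Σ (ℕ → A) λ t → ∀ i → t (code i) ≡ f i
  extend-along-injection {I} {A} default code code-inj f = (λ n → pick n em) , λ i → pick-code i em
    where
      pick : (n : ℕ) → Dec (∃ λ i → code i ≡ n) → A
      pick n (yes (i , _)) = f i
      pick n (no _)        = default

      pick-code : ∀ i (d : Dec (∃ λ j → code j ≡ code i)) → pick (code i) d ≡ f i
      pick-code i (yes (j , eq)) = cong f (code-inj eq)
      pick-code i (no none)      = contradiction (i , refl) none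

  fresh-above : {A : Set} (f : ℕ → A) → Injective _≡_ _≡_ f → (U : List A) → (m : ℕ) →
                ∃ λ p → m ≤ p × f p ∉ U
  fresh-above f f-inj []      m = m , ≤-refl , λ ()
  fresh-above f f-inj (x ∷ U) m with fresh-above f f-inj U m
  ... | p , m≤p , p∉U with em {f p ≡ x}
  ...   | no fp≢x = p , m≤p , λ { (here eq) → fp≢x eq ; (there p∈U) → p∉U p∈U }
  ...   | yes fp≡x with fresh-above f f-inj U (suc p)
  ...     | q , p<q , q∉U =
    q , ≤-trans m≤p (<⇒≤ p<q) ,
    λ { (here eq) → <-irrefl (f-inj (trans fp≡x (sym eq))) p<q ; (there q∈U) → q∉U q∈U }

  another-colour : ∀ {A : Set} {a b : A} → a ≢ b → (x : A) → ∃ λ y → y ≢ x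
  another-colour {a = a} {b} a≢b x with em {x ≡ a}
  ... | yes refl = b , a≢b ∘ sym
  ... | no x≢a   = a , x≢a ∘ sym

  module _ {C : Set} where

    Meets : (ℕ → ℕ → C) → Requirement → ℕ → C → Set
    Meets t (i , true)  p c = c ≡ t i p
    Meets t (i , false) p c = c ≢ t i p

    Serves : (ℕ → ℕ → C) → (ℕ → C) → Set
    Serves t w = ∀ r → ∃ λ k → r ≤ k × Meets t (schedule r) k (w k)

    serves⇒ωω-feedback : ∀ {t w} → Serves t w → ∀ i → IsFeedback (t i) w ωω
    serves⇒ωω-feedback {t} {w} serves i = often true sym , often false (λ w≢t t≡w → w≢t (sym t≡w))
      where
        often : ∀ {P : ℕ → Set} b → (∀ {k} → Meets t (i , b) k (w k) → P k) → HasSize P omega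
        often b meets⇒P m with schedule-recurrent (i , b) m
        ... | r , m≤r , refl with serves r
        ... | k , r≤k , meets = k , ≤-trans m≤r r≤k , meets⇒P meets

    serving-codeword : ∀ {a b : C} → a ≢ b → (t : ℕ → ℕ → C) → ∃ (Serves t)
    serving-codeword a≢b t =
      (λ k → proj₁ (meet (schedule k) k)) , λ r → r , ≤-refl , proj₂ (meet (schedule r) r)
      where
        meet : ∀ q p → Σ C (Meets t q p)
        meet (i , true)  p = t i p , refl
        meet (i , false) p = another-colour a≢b (t i p)

    module InjectiveServing (e : ℕ → C) (e-inj : Injective _≡_ _≡_ e)
                            (t : ℕ → ℕ → C) (t-inj : ∀ i → Injective _≡_ _≡_ (t i)) where

      record Promise (U : List C) (k : ℕ) (q : Requirement) : Set where
        constructor promise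
        field
          pos   : ℕ
          col   : C
          k≤pos : k ≤ pos
          fresh : col ∉ U
          meets : Meets t q pos col
      open Promise

      promise-for : ∀ q U k → Promise U k q
      promise-for (i , true) U k with fresh-above (t i) (t-inj i) U k
      ... | p , k≤p , p∉U = promise p (t i p) k≤p p∉U refl
      promise-for (i , false) U k with fresh-above e e-inj (t i k ∷ U) 0
      ... | m , _ , m∉ = promise k (e m) ≤-refl (m∉ ∘ there) (m∉ ∘ here)

      -- The construction before position k: the colours of positions < k, and the promise
      -- made for the requirement in service.
      record State (k : ℕ) : Set where
        constructor state
        field
          used     : List C
          req      : ℕ
          promised : Promise used k (schedule req)
      open State

      filler : (c : C) (U : List C) → ∃ λ x → x ∉ c ∷ U
      filler c U with fresh-above e e-inj (c ∷ U) 0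
      ... | m , _ , m∉ = e m , m∉

      out : ∀ {k} → State k → C
      out {k} (state U r (promise p c _ _ _)) with p ≟ k
      ... | yes _ = c
      ... | no _  = proj₁ (filler c U)

      next : ∀ {k} → State k → State (suc k)
      next {k} (state U r (promise p c k≤p c∉U meets)) with p ≟ k
      ... | yes _   = state (c ∷ U) (suc r) (promise-for (schedule (suc r)) (c ∷ U) (suc k))
      ... | no p≢k  = state (x ∷ U) r (promise p c (≤∧≢⇒< k≤p (p≢k ∘ sym)) c∉x∷U meets)
        where
          x = proj₁ (filler c U)
          c∉x∷U : c ∉ x ∷ U
          c∉x∷U (here c≡x)  = proj₂ (filler c U) (here (sym c≡x))
          c∉x∷U (there c∈U) = c∉U c∈U

      next-used : ∀ {k} (s : State k) → used (next s) ≡ out s ∷ used s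
      next-used {k} (state U r (promise p c _ _ _)) with p ≟ k
      ... | yes _ = refl
      ... | no _  = refl

      out-fresh : ∀ {k} (s : State k) → out s ∉ used s
      out-fresh {k} (state U r (promise p c _ c∉U _)) with p ≟ k
      ... | yes _ = c∉U
      ... | no _  = proj₂ (filler c U) ∘ there

      next-req-≤ : ∀ {k} (s : State k) → req (next s) ≤ suc (req s)
      next-req-≤ {k} (state U r (promise p c _ _ _)) with p ≟ k
      ... | yes _ = ≤-refl
      ... | no _  = n≤1+n r

      next-waiting : ∀ {k} (s : State k) → pos (promised s) ≢ k →
                     pos (promised (next s)) ≡ pos (promised s) × req (next s) ≡ req s
      next-waiting {k} (state U r (promise p c _ _ _)) p≢k with p ≟ k
      ... | yes p≡k = contradiction p≡k p≢k
      ... | no _    = refl , refl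

      next-fulfilling : ∀ {k} (s : State k) → pos (promised s) ≡ k →
                        Meets t (schedule (req s)) k (out s) × req (next s) ≡ suc (req s)
      next-fulfilling {k} (state U r (promise p c _ _ meets)) p≡k with p ≟ k
      ... | yes refl = meets , refl
      ... | no p≢k   = contradiction p≡k p≢k

      state-at : (k : ℕ) → State k
      state-at zero    = state [] 0 (promise-for (schedule 0) [] 0)
      state-at (suc k) = next (state-at k)

      w : ℕ → C
      w k = out (state-at k)

      used-earlier : ∀ {j k} → j < k → w j ∈ used (state-at k)
      used-earlier {j} {suc k} (s≤s j≤k) rewrite next-used (state-at k) with m≤n⇒m<n∨m≡n j≤k
      ... | inj₁ j<k  = there (used-earlier j<k)
      ... | inj₂ refl = here refl

      w-injective : Injective _≡_ _≡_ w
      w-injective = earlier-distinct⇒injective λ {j} {k} j<k wj≡wk →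
        out-fresh (state-at k) (subst (_∈ used (state-at k)) wj≡wk (used-earlier j<k))

      req-≤ : ∀ k → req (state-at k) ≤ k
      req-≤ zero    = z≤n
      req-≤ (suc k) = ≤-trans (next-req-≤ (state-at k)) (s≤s (req-≤ k))

      Fulfils : ℕ → ℕ → Set
      Fulfils r k = pos (promised (state-at k)) ≡ k × req (state-at k) ≡ r

      fulfilled-within : ∀ d k → pos (promised (state-at k)) ≡ d + k →
                         ∃ (Fulfils (req (state-at k)))
      fulfilled-within zero    k p≡k = k , p≡k , refl
      fulfilled-within (suc d) k p≡1+d+k
        with next-waiting (state-at k) (λ p≡k → <-irrefl (trans (sym p≡k) p≡1+d+k) (s≤s (m≤n+m k d)))
      ... | pos≡ , req≡
        with fulfilled-within d (suc k) (trans pos≡ (trans p≡1+d+k (sym (+-suc d k))))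
      ... | k' , p≡k' , req≡' = k' , p≡k' , trans req≡' req≡

      fulfilled : ∀ k → ∃ (Fulfils (req (state-at k)))
      fulfilled k = fulfilled-within (pos (promised s) ∸ k) k (sym (m∸n+n≡m (k≤pos (promised s))))
        where s = state-at k

      every-requirement-fulfilled : ∀ r → ∃ (Fulfils r)
      every-requirement-fulfilled zero    = fulfilled 0
      every-requirement-fulfilled (suc r) with every-requirement-fulfilled r
      ... | k , p≡k , refl with fulfilled (suc k)
      ... | k' , p≡k' , req≡ = k' , p≡k' , trans req≡ (proj₂ (next-fulfilling (state-at k) p≡k))

      w-serves : Serves t w
      w-serves r with every-requirement-fulfilled r
      ... | k , p≡k , refl = k , req-≤ k , proj₁ (next-fulfilling (state-at k) p≡k)

    injective-serving-codeword : (e : ℕ → C) → Injective _≡_ _≡_ e →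
                                 (t : ℕ → ℕ → C) → (∀ i → Injective _≡_ _≡_ (t i)) →
                                 Σ (ℕ → C) λ w → Injective _≡_ _≡_ w × Serves t w
    injective-serving-codeword e e-inj t t-inj = w , w-injective , w-serves
      where open InjectiveServing e e-inj t t-inj

    some-word : (v : Variant) → EnoughColors v C → Word v C
    some-word dup   (a , _)         = (λ _ → a) , tt
    some-word nodup (_ , e , e-inj) = e , e-inj

    Hidden : ∀ {v} {I : Set} → (I → Word v C) → Word v C → Set
    Hidden f w = ∀ i → IsFeedback (seq (f i)) (seq w) ωω

    hidden-codeword : (v : Variant) → EnoughColors v C → (t : ℕ → Word v C) → ∃ (Hidden t)
    hidden-codeword dup (_ , _ , a≢b) t with serving-codeword a≢b (seq ∘ t)
    ... | w , serves = (w , tt) , serves⇒ωω-feedback serves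
    hidden-codeword nodup (_ , e , e-inj) t
      with injective-serving-codeword e e-inj (seq ∘ t) (proj₂ ∘ t)
    ... | w , w-inj , serves = (w , w-inj) , serves⇒ωω-feedback serves

  module _ (v : Variant) (C : Set) (colours : EnoughColors v C) where

    record Subfamily {I : Set} (f : I → Word v C) (t : ℕ → Word v C) : Set where
      field
        index    : I → ℕ
        is-entry : ∀ i → t (index i) ≡ f i

    countable⇒subfamily : ∀ {I : Set} (code : I → ℕ) → Injective _≡_ _≡_ code → (f : I → Word v C) →
                          ∃ (Subfamily f)
    countable⇒subfamily code code-inj f
      with extend-along-injection (some-word v colours) code code-inj f
    ... | t , is-entry = t , record { index = code ; is-entry = is-entry }

    hidden-on-subfamily : ∀ {I : Set} {f : I → Word v C} {t} →
                          Subfamily f t → ∀ w → Hidden t w → Hidden f w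
    hidden-on-subfamily f⊑t w hidden i =
      subst (λ s → IsFeedback (seq s) (seq w) ωω) (is-entry i) (hidden (index i))
      where open Subfamily f⊑t

    no-winning-strategy : (γ : CountableOrdinal) → ¬ (Σ (Strategy v C γ) λ σ → WinsBy {v} {C} {γ} σ)
    no-winning-strategy γ (σ , wins)
      with countable⇒subfamily (code γ) (codeInj γ) (guessAt {v} {C} {γ} σ (λ _ → ωω))
    ... | t , guesses⊑t with hidden-codeword v colours t
    ... | w , hidden-t with hidden-on-subfamily guesses⊑t w hidden-t
    ... | hidden-guesses with wins w ((λ _ → ωω) , hidden-guesses)
    ... | α , guess≗w = ωω-feedback⇒≢ (hidden-guesses α) guess≗w

    no-countable-winning-set : ¬ (Σ (CountableGuessSet v C) λ S → IsWinningSet {v} {C} S)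
    no-countable-winning-set (S , determined)
      with countable⇒subfamily (CountableGuessSet.code S) (CountableGuessSet.codeInj S)
                               (CountableGuessSet.member S)
    ... | t , S⊑t with hidden-codeword v colours t
    ... | w , hidden-t with hidden-codeword v colours (λ { zero → w ; (suc n) → t n })
    ... | w′ , hidden-w∷t = ωω-feedback⇒≢ (hidden-w∷t 0) (determined w w′ same-feedback)
      where
        same-feedback : ∀ i c → IsFeedback (seq (CountableGuessSet.member S i)) (seq w) c
                              → IsFeedback (seq (CountableGuessSet.member S i)) (seq w′) c
        same-feedback i c feedback
          with ωω-feedback-unique (hidden-on-subfamily S⊑t w hidden-t i) feedback
        ... | refl = hidden-on-subfamily S⊑t w′ (hidden-w∷t ∘ suc) i

open Classical

mainTheorem11 : ExcludedMiddle 0ℓ → (v : Variant) → (C : Set) → EnoughColors v C →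
    ((γ : CountableOrdinal) → ¬ (Σ (Strategy v C γ) λ σ → WinsBy {v} {C} {γ} σ))
    × ¬ (Σ (CountableGuessSet v C) λ S → IsWinningSet {v} {C} S)
mainTheorem11 em v C colours =
  no-winning-strategy em v C colours , no-countable-winning-set em v C colours
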